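{- Let $a \ge 1$ and $q \ge 2$ be integers and $\alpha \ge 0$ a real number. If $M$ is a matroid with $\tau_a(M) \ge \alpha q^{r(M)}$, then $M$ has a weakly round restriction $N$ such that $\tau_a(N) \ge \alpha q^{r(N)}$.
   Context: All matroids are finite. For a matroid $M$ and a positive integer $a$, $\tau_a(M)$ denotes the minimum number of subsets of $E(M)$, each of rank at most $a$ in $M$, whose union is $E(M)$. A matroid $M$ is weakly round if there do not exist sets $A,B$ with $A \cup B = E(M)$, $r_M(A) \le r(M)-2$ and $r_M(B) \le r(M)-1$.
   Formalization: The parameter α ranges over the nonnegative rationals instead of the nonnegative reals. -}

module Defs where

open import Data.Nat using (ℕ; _≤_; _+_; _<_; suc; zero)
open import Data.Fin using (Fin)
import Data.Fin as F
open import Data.Fin.Subset using (Subset; _⊆_; _∪_; _∩_; ∣_∣; ⊥)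
open import Data.Product using (Σ; _×_)
open import Data.Integer using (+_)
open import Data.Rational using (ℚ; _/_)
open import Relation.Binary.PropositionalEquality using (_≡_)
open import Relation.Nullary using (¬_)

record Matroid (n : ℕ) : Set where
  field
    rank        : Subset n → ℕ
    rank-bound  : ∀ X → rank X ≤ ∣ X ∣
    rank-mono   : ∀ {X Y} → X ⊆ Y → rank X ≤ rank Y
    rank-submod : ∀ X Y → rank (X ∪ Y) + rank (X ∩ Y) ≤ rank X + rank Y
open Matroid public

⋃ : ∀ {n k} → (Fin k → Subset n) → Subset n
⋃ {k = zero}  G = ⊥
⋃ {k = suc k} G = G F.zero ∪ ⋃ (λ i → G (F.suc i))

-- Restrictions: the restriction M|X (X ⊆ E(M)) is represented by the subset X;
-- its ground set is X, and r_{M|X}(A) = r_M(A) for A ⊆ X, so r(M|X) = rank M X.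

Cover : ∀ {n} → Matroid n → ℕ → Subset n → ℕ → Set
Cover {n} M a X k =
  Σ (Fin k → Subset n) λ G →
    ((i : Fin k) → (G i ⊆ X) × (rank M (G i) ≤ a)) × (⋃ G ≡ X)

Tau : ∀ {n} → Matroid n → ℕ → Subset n → ℕ → Set
Tau M a X t = Cover M a X t × (∀ k → k < t → ¬ Cover M a X k)

-- M|X is weakly round: there are no A, B ⊆ X with A ∪ B = X,
-- r(A) ≤ r(M|X) - 2 and r(B) ≤ r(M|X) - 1 (integer subtraction, so written additively).
WeaklyRound : ∀ {n} → Matroid n → Subset n → Set
WeaklyRound M X =
  ∀ A B → A ⊆ X → B ⊆ X → A ∪ B ≡ X →
    rank M A + 2 ≤ rank M X → rank M B + 1 ≤ rank M X → Data.Empty.⊥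
  where import Data.Empty

ℕ→ℚ : ℕ → ℚ
ℕ→ℚ k = (+ k) / 1

-- If M|X is not weakly round, take A ∪ B = X with r(A) ≤ r(X) − 2 and r(B) ≤ r(X) − 1.
-- Covers of A and B combine into a cover of X, so τ_a(X) ≤ τ_a(A) + τ_a(B), while
-- q^{r(X)−2} + q^{r(X)−1} ≤ q^{r(X)} as q ≥ 2; hence τ_a ≥ α q^r passes to A or to B.
-- Repeating this strictly lowers the rank, so it stops at a weakly round restriction.
module Submission where

open import Defs
open import Data.Nat using (ℕ; _≤_; _^_)
open import Data.Fin.Subset using (Subset; _⊆_; ⊤)
open import Data.Product using (Σ; _×_)
open import Data.Rational using (ℚ; _*_) renaming (_≤_ to _≤ℚ_)

open import Data.Nat using (suc; zero; _<_; _+_; _≤?_; z≤n; s≤s) renaming (_*_ to _*ₙ_)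
import Data.Nat.Properties as ℕₚ
open import Data.Nat.Induction using (<-wellFounded)
open import Induction.WellFounded using (Acc; acc)
import Data.Integer as ℤ
import Data.Integer.Properties as ℤₚ
import Data.Rational as ℚ
import Data.Rational.Properties as ℚₚ
open import Data.Nat.Coprimality using (1-coprimeTo) renaming (sym to coprime-sym)
open import Data.Fin using (Fin; splitAt)
import Data.Fin as Fin
open import Data.Fin.Subset using (_∪_; _∩_) renaming (⊥ to ⊥ₛ)
import Data.Fin.Subset.Properties as Subsetₚ
open import Data.Vec.Functional using (_++_; _∷_; head; tail)
open import Data.Vec.Properties using (≡-dec)
import Data.Bool as Bool
open import Data.Product using (_,_; proj₁; proj₂)
open import Data.Sum using (_⊎_; inj₁; inj₂)
import Data.Sum as Sum
open import Data.Sum.Properties using ([,]-map)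
open import Data.Empty using (⊥-elim)
open import Relation.Nullary using (¬_; Dec; yes; no)
open import Relation.Nullary.Decidable using (_×-dec_; map′)
open import Relation.Binary.PropositionalEquality
open import Function using (_∘_)

ℕ→ℚ≡mkℚ : ∀ x → ℕ→ℚ x ≡ ℚ.mkℚ (ℤ.+ x) 0 (coprime-sym (1-coprimeTo x))
ℕ→ℚ≡mkℚ x = ℚₚ.normalize-coprime (coprime-sym (1-coprimeTo x))

ℕ→ℚ-mono-≤ : ∀ {x y} → x ≤ y → ℕ→ℚ x ≤ℚ ℕ→ℚ y
ℕ→ℚ-mono-≤ {x} {y} x≤y rewrite ℕ→ℚ≡mkℚ x | ℕ→ℚ≡mkℚ y =
  ℚ.*≤* (subst₂ ℤ._≤_ (sym (ℤₚ.*-identityʳ (ℤ.+ x))) (sym (ℤₚ.*-identityʳ (ℤ.+ y)))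
                      (ℤ.+≤+ x≤y))

ℕ→ℚ-homo-+ : ∀ x y → ℕ→ℚ (x + y) ≡ ℕ→ℚ x ℚ.+ ℕ→ℚ y
ℕ→ℚ-homo-+ x y rewrite ℕ→ℚ≡mkℚ x | ℕ→ℚ≡mkℚ y =
  cong (ℚ._/ 1) (sym (cong₂ ℤ._+_ (ℤₚ.*-identityʳ (ℤ.+ x)) (ℤₚ.*-identityʳ (ℤ.+ y))))

+-≤-split : ∀ {p q r s : ℚ} → p ℚ.+ q ≤ℚ r ℚ.+ s → p ≤ℚ r ⊎ q ≤ℚ s
+-≤-split {p} {q} {r} {s} p+q≤r+s with p ℚₚ.≤? r | q ℚₚ.≤? s
... | yes p≤r | _       = inj₁ p≤r
... | no _    | yes q≤s = inj₂ q≤s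
... | no p≰r  | no q≰s  =
  ⊥-elim (ℚₚ.<-irrefl refl (ℚₚ.<-≤-trans (ℚₚ.+-mono-< (ℚₚ.≰⇒> p≰r) (ℚₚ.≰⇒> q≰s)) p+q≤r+s))

suc-≤-square : ∀ {q} → 2 ≤ q → suc q ≤ q *ₙ q
suc-≤-square {q@(suc _)} 2≤q = begin
  suc q         ≡⟨ ℕₚ.+-comm 1 q ⟩
  q + 1         ≤⟨ ℕₚ.+-monoʳ-≤ q (s≤s z≤n) ⟩
  2 *ₙ q        ≤⟨ ℕₚ.*-monoˡ-≤ q 2≤q ⟩
  q *ₙ q        ∎
  where open ℕₚ.≤-Reasoning

^-+-≤ : ∀ {q} → 2 ≤ q → ∀ {i j r} → 2 + i ≤ r → 1 + j ≤ r → q ^ i + q ^ j ≤ q ^ r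
^-+-≤ {q@(suc _)} 2≤q {i} {j} {suc (suc m)} (s≤s (s≤s i≤m)) (s≤s j≤1+m) = begin
  q ^ i + q ^ j       ≤⟨ ℕₚ.+-mono-≤ (ℕₚ.^-monoʳ-≤ q i≤m) (ℕₚ.^-monoʳ-≤ q j≤1+m) ⟩
  suc q *ₙ q ^ m      ≤⟨ ℕₚ.*-monoˡ-≤ (q ^ m) (suc-≤-square 2≤q) ⟩
  q *ₙ q *ₙ q ^ m     ≡⟨ ℕₚ.*-assoc q q (q ^ m) ⟩
  q ^ suc (suc m)     ∎
  where open ℕₚ.≤-Reasoning

Minimal : (ℕ → Set) → ℕ → Set
Minimal P s = P s × (∀ k → k < s → ¬ P k)

minimal-exists : ∀ {P : ℕ → Set} → (∀ k → Dec (P k)) → ∀ {k} → P k → Σ ℕ (Minimal P)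
minimal-exists {P} P? = go (<-wellFounded _)
  where
  go : ∀ {k} → Acc _<_ k → P k → Σ ℕ (Minimal P)
  go {k} (acc smaller) pk with ℕₚ.anyUpTo? P? k
  ... | yes (j , j<k , pj) = go (smaller j<k) pj
  ... | no none            = k , pk , λ j j<k pj → none (j , j<k , pj)

⋃-cong : ∀ {n k} {G H : Fin k → Subset n} → (∀ i → G i ≡ H i) → ⋃ G ≡ ⋃ H
⋃-cong {k = zero}  G≗H = refl
⋃-cong {k = suc k} G≗H = cong₂ _∪_ (G≗H Fin.zero) (⋃-cong (G≗H ∘ Fin.suc))

⋃-∩ : ∀ {n k} (G : Fin k → Subset n) A → ⋃ (λ i → G i ∩ A) ≡ ⋃ G ∩ A
⋃-∩ {k = zero}  G A = sym (Subsetₚ.∩-zeroˡ A)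
⋃-∩ {k = suc k} G A = trans (cong (head G ∩ A ∪_) (⋃-∩ (tail G) A))
                            (sym (Subsetₚ.∩-distribʳ-∪ A (head G) (⋃ (tail G))))

⋃-++ : ∀ {n s u} (G : Fin s → Subset n) (H : Fin u → Subset n) → ⋃ (G ++ H) ≡ ⋃ G ∪ ⋃ H
⋃-++ {s = zero}  G H = sym (Subsetₚ.∪-identityˡ (⋃ H))
⋃-++ {s = suc s} G H = begin
  head G ∪ ⋃ (tail (G ++ H))      ≡⟨ cong (head G ∪_) (⋃-cong (λ i → [,]-map (splitAt s i))) ⟩
  head G ∪ ⋃ (tail G ++ H)        ≡⟨ cong (head G ∪_) (⋃-++ (tail G) H) ⟩
  head G ∪ (⋃ (tail G) ∪ ⋃ H)     ≡⟨ Subsetₚ.∪-assoc (head G) (⋃ (tail G)) (⋃ H) ⟨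
  ⋃ G ∪ ⋃ H                       ∎
  where open ≡-Reasoning

++-all : ∀ {n s u} {P : Subset n → Set} {G : Fin s → Subset n} {H : Fin u → Subset n} →
         (∀ i → P (G i)) → (∀ i → P (H i)) → ∀ i → P ((G ++ H) i)
++-all {s = s} PG PH i with splitAt s i
... | inj₁ j = PG j
... | inj₂ j = PH j

module _ {n} (Good : Subset n → Set) (Good? : ∀ S → Dec (Good S)) where

  FamilyWithUnion : ℕ → (Subset n → Set) → Set
  FamilyWithUnion k P = Σ (Fin k → Subset n) λ G → (∀ i → Good (G i)) × P (⋃ G)

  familyWithUnion? : ∀ k {P} → (∀ U → Dec (P U)) → Dec (FamilyWithUnion k P)
  familyWithUnion? zero    P? with P? ⊥ₛ
  ... | yes P∅ = yes ((λ ()) , (λ ()) , P∅)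
  ... | no ¬P∅ = no λ (_ , _ , P∅) → ¬P∅ P∅
  familyWithUnion? (suc k) P? =
    map′ (λ (S , GoodS , G , GoodG , P⋃) →
            S ∷ G , (λ { Fin.zero → GoodS ; (Fin.suc i) → GoodG i }) , P⋃)
         (λ (G , GoodG , P⋃) → head G , GoodG Fin.zero , tail G , GoodG ∘ Fin.suc , P⋃)
         (Subsetₚ.anySubset? λ S → Good? S ×-dec familyWithUnion? k (λ U → P? (S ∪ U)))

cover? : ∀ {n} (M : Matroid n) a X k → Dec (Cover M a X k)
cover? M a X k =
  familyWithUnion? _ (λ S → (S Subsetₚ.⊆? X) ×-dec (rank M S ≤? a)) k (λ U → ≡-dec Bool._≟_ U X)

cover-restrict : ∀ {n} (M : Matroid n) {a X A k} → A ⊆ X → Cover M a X k → Cover M a A k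
cover-restrict M {X = X} {A} A⊆X (G , G⊆X , ⋃G≡X) =
  (λ i → G i ∩ A) ,
  (λ i → Subsetₚ.p∩q⊆q (G i) A , ℕₚ.≤-trans (rank-mono M (Subsetₚ.p∩q⊆p (G i) A)) (proj₂ (G⊆X i))) ,
  trans (⋃-∩ G A) (trans (cong (_∩ A) ⋃G≡X) X∩A≡A)
  where
  X∩A≡A : X ∩ A ≡ A
  X∩A≡A = Subsetₚ.⊆-antisym (Subsetₚ.p∩q⊆q X A) (λ x∈A → Subsetₚ.x∈p∩q⁺ (A⊆X x∈A , x∈A))

cover-∪ : ∀ {n} (M : Matroid n) {a X A B s u} → A ⊆ X → B ⊆ X → A ∪ B ≡ X →
          Cover M a A s → Cover M a B u → Cover M a X (s + u)
cover-∪ M {a} {X} A⊆X B⊆X A∪B≡X (G , G-ok , ⋃G≡A) (H , H-ok , ⋃H≡B) =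
  G ++ H ,
  ++-all {P = λ S → (S ⊆ X) × (rank M S ≤ a)}
    (λ i → A⊆X ∘ proj₁ (G-ok i) , proj₂ (G-ok i))
    (λ i → B⊆X ∘ proj₁ (H-ok i) , proj₂ (H-ok i)) ,
  trans (⋃-++ G H) (trans (cong₂ _∪_ ⋃G≡A ⋃H≡B) A∪B≡X)

tau-⊆ : ∀ {n} (M : Matroid n) {a X A t} → A ⊆ X → Tau M a X t → Σ ℕ (Tau M a A)
tau-⊆ M {a} {A = A} A⊆X (coverX , _) = minimal-exists (cover? M a A) (cover-restrict M A⊆X coverX)

tau-∪-≤ : ∀ {n} (M : Matroid n) {a X A B t s u} → A ⊆ X → B ⊆ X → A ∪ B ≡ X →
          Tau M a X t → Tau M a A s → Tau M a B u → t ≤ s + u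
tau-∪-≤ M A⊆X B⊆X A∪B≡X (_ , minimal) (coverA , _) (coverB , _) =
  ℕₚ.≮⇒≥ λ s+u<t → minimal _ s+u<t (cover-∪ M A⊆X B⊆X A∪B≡X coverA coverB)

Violation : ∀ {n} → Matroid n → Subset n → Set
Violation M X = Σ (Subset _) λ A → Σ (Subset _) λ B →
  (A ⊆ X) × (B ⊆ X) × (A ∪ B ≡ X) × (rank M A + 2 ≤ rank M X) × (rank M B + 1 ≤ rank M X)

violation? : ∀ {n} (M : Matroid n) X → Dec (Violation M X)
violation? M X = Subsetₚ.anySubset? λ A → Subsetₚ.anySubset? λ B →
  (A Subsetₚ.⊆? X) ×-dec (B Subsetₚ.⊆? X) ×-dec ≡-dec Bool._≟_ (A ∪ B) X ×-dec
  (rank M A + 2 ≤? rank M X) ×-dec (rank M B + 1 ≤? rank M X)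

+-pos-≤⇒< : ∀ {m k r} → m + suc k ≤ r → m < r
+-pos-≤⇒< {m} m+k≤r = ℕₚ.<-≤-trans (ℕₚ.m<m+n m (s≤s z≤n)) m+k≤r

module _ {n} (M : Matroid n) (a q : ℕ) (α : ℚ) (2≤q : 2 ≤ q) (0≤α : ℕ→ℚ 0 ≤ℚ α) where

  Dense : Subset n → Set
  Dense X = Σ ℕ λ s → Tau M a X s × (α * ℕ→ℚ (q ^ rank M X) ≤ℚ ℕ→ℚ s)

  dense-⊎ : ∀ {X A B} → A ⊆ X → B ⊆ X → A ∪ B ≡ X →
            rank M A + 2 ≤ rank M X → rank M B + 1 ≤ rank M X →
            Dense X → Dense A ⊎ Dense B
  dense-⊎ {X} {A} {B} A⊆X B⊆X A∪B≡X rA+2≤rX rB+1≤rX (t , τX , bound) =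
    Sum.map (λ boundA → sA , τA , boundA) (λ boundB → sB , τB , boundB) (+-≤-split bound-sum)
    where
    instance _ = ℚ.nonNegative 0≤α
    τ-of-A : Σ ℕ (Tau M a A)
    τ-of-A = tau-⊆ M A⊆X τX
    sA : ℕ
    sA = proj₁ τ-of-A
    τA : Tau M a A sA
    τA = proj₂ τ-of-A
    τ-of-B : Σ ℕ (Tau M a B)
    τ-of-B = tau-⊆ M B⊆X τX
    sB : ℕ
    sB = proj₁ τ-of-B
    τB : Tau M a B sB
    τB = proj₂ τ-of-B
    qA qB : ℕ
    qA = q ^ rank M A
    qB = q ^ rank M B
    qA+qB≤qX : qA + qB ≤ q ^ rank M X
    qA+qB≤qX = ^-+-≤ 2≤q (subst (_≤ rank M X) (ℕₚ.+-comm (rank M A) 2) rA+2≤rX)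
                         (subst (_≤ rank M X) (ℕₚ.+-comm (rank M B) 1) rB+1≤rX)
    open ℚₚ.≤-Reasoning
    bound-sum : α * ℕ→ℚ qA ℚ.+ α * ℕ→ℚ qB ≤ℚ ℕ→ℚ sA ℚ.+ ℕ→ℚ sB
    bound-sum = begin
      α * ℕ→ℚ qA ℚ.+ α * ℕ→ℚ qB ≡⟨ trans (cong (α *_) (ℕ→ℚ-homo-+ qA qB)) (ℚₚ.*-distribˡ-+ α _ _) ⟨
      α * ℕ→ℚ (qA + qB)         ≤⟨ ℚₚ.*-monoˡ-≤-nonNeg α (ℕ→ℚ-mono-≤ qA+qB≤qX) ⟩
      α * ℕ→ℚ (q ^ rank M X)    ≤⟨ bound ⟩
      ℕ→ℚ t                     ≤⟨ ℕ→ℚ-mono-≤ (tau-∪-≤ M A⊆X B⊆X A∪B≡X τX τA τB) ⟩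
      ℕ→ℚ (sA + sB)             ≤⟨ ℚₚ.≤-reflexive (ℕ→ℚ-homo-+ sA sB) ⟩
      ℕ→ℚ sA ℚ.+ ℕ→ℚ sB         ∎

  weaklyRound-dense : ∀ {X} → Acc _<_ (rank M X) → Dense X →
                      Σ (Subset n) λ Y → WeaklyRound M Y × Dense Y
  weaklyRound-dense {X} (acc smaller) denseX with violation? M X
  ... | no ¬violation =
    X , (λ A B A⊆X B⊆X A∪B≡X rA rB → ¬violation (A , B , A⊆X , B⊆X , A∪B≡X , rA , rB)) , denseX
  ... | yes (A , B , A⊆X , B⊆X , A∪B≡X , rA+2≤rX , rB+1≤rX) =
    Sum.[ weaklyRound-dense (smaller (+-pos-≤⇒< rA+2≤rX))
             , weaklyRound-dense (smaller (+-pos-≤⇒< rB+1≤rX)) ]′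
      (dense-⊎ A⊆X B⊆X A∪B≡X rA+2≤rX rB+1≤rX denseX)

-- The hypothesis 1 ≤ a only guarantees that τ_a exists; here τ_a(M) = t is given.
lemma7p1 : (a q : ℕ) → 1 ≤ a → 2 ≤ q → (α : ℚ) → ℕ→ℚ 0 ≤ℚ α →
    {n : ℕ} (M : Matroid n) (t : ℕ) → Tau M a ⊤ t →
    α * ℕ→ℚ (q ^ rank M ⊤) ≤ℚ ℕ→ℚ t →
    Σ (Subset n) λ X → Σ ℕ λ s →
    WeaklyRound M X × Tau M a X s × (α * ℕ→ℚ (q ^ rank M X) ≤ℚ ℕ→ℚ s)
lemma7p1 a q _ 2≤q α 0≤α M t τ bound =
  let X , roundX , s , τX , boundX =
        weaklyRound-dense M a q α 2≤q 0≤α (<-wellFounded (rank M ⊤)) (t , τ , bound)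
  in X , s , roundX , τX , boundX
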